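{- Let $F:\mathcal V\to\mathcal W$ be a functor between small categories and $F_*:\widehat{\mathcal V}\to\widehat{\mathcal W}$ the weak CwF morphism described below. Then $F_*$ preserves $\Sigma$-types and identity types up to isomorphism: for types $\Gamma\vdash A$ and $\Gamma.A\vdash B$ there is an isomorphism of types over $F_*\Gamma$ between $F_*(\Sigma A B)$ and $\Sigma(F_*A)((F_*B)[\theta])$, compatible with pairing and projections, where $\theta:(F_*\Gamma).(F_*A)\to F_*(\Gamma.A)$ is the inverse of the comprehension isomorphism $(F_*\pi,F_*\xi)$; and for terms $\Gamma\vdash a,b:A$ there is an isomorphism of types over $F_*\Gamma$ between $F_*(a=_Ab)$ and $(F_*a=_{F_*A}F_*b)$.
   Context: Presheaf CwF $\widehat{\mathcal V}$: contexts are presheaves on $\mathcal V$; a type $\Gamma\vdash T$ is given by sets $T[\gamma]$ ($\gamma\in\Gamma(V)$) with functorial restrictions $t\mapsto t\langle\varphi\rangle\in T[\gamma\cdot\varphi]$; a term is a restriction-compatible family $t[\gamma]\in T[\gamma]$; $\mathrm{Tm}(\Delta,S)$ denotes the set of terms of $S$ in context $\Delta$; $(\Gamma.T)(V)=\{(\gamma,t)\}$, $\pi(\gamma,t)=\gamma$, $\xi[(\gamma,t)]=t$. The $\Sigma$-type is $(\Sigma AB)[\gamma]=\{(a,b):a\in A[\gamma],b\in B[(\gamma,a)]\}$ with componentwise restriction; the identity type $(a=_Ab)[\gamma]$ is $\{\star\}$ if $a[\gamma]=b[\gamma]$ and empty otherwise. $F^*:\widehat{\mathcal W}\to\widehat{\mathcal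 V}$ is precomposition with $F$. $F_*$ is defined on contexts by $(F_*\Gamma)(W)=\mathrm{Hom}(F^*\mathbf yW,\Gamma)$ (restriction along $\varphi$ by precomposition with $F^*\mathbf y\varphi$); on types by $(F_*T)[\sigma]=\mathrm{Tm}(F^*\mathbf yW,T[\sigma])$ for $\sigma:F^*\mathbf yW\to\Gamma$, with restriction $t\mapsto t[F^*\mathbf y\varphi]$; on terms by $(F_*t)[\sigma]=t[\sigma]$. -}

module Defs where

-- Equality is propositional equality; Agda's default axiom K (UIP) is used,
-- so all sets behave as sets in the set-theoretic sense.  Function
-- extensionality is needed to even *define* F_* (its presheaf and type laws
-- are equalities of natural transformations / terms); it is passed in as an
-- explicit argument 'fe'.

open import Level using (0ℓ)
open import Relation.Binary.PropositionalEquality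
open import Axiom.Extensionality.Propositional using (Extensionality; implicit-extensionality)
open import Axiom.UniquenessOfIdentityProofs.WithK using (uip)
open import Data.Product using (Σ; _,_; proj₁; proj₂; _×_)

Σ≡ : {A : Set} {P : A → Set} {a₁ a₂ : A} {b₁ : P a₁} {b₂ : P a₂}
     (p : a₁ ≡ a₂) → subst P p b₁ ≡ b₂ → _≡_ {A = Σ A P} (a₁ , b₁) (a₂ , b₂)
Σ≡ refl refl = refl

record Category : Set₁ where
  infixr 9 _∘_
  field
    Obj   : Set
    Hom   : Obj → Obj → Set
    id    : ∀ {A} → Hom A A
    _∘_   : ∀ {A B C} → Hom B C → Hom A B → Hom A C
    idˡ   : ∀ {A B} (f : Hom A B) → id ∘ f ≡ f
    idʳ   : ∀ {A B} (f : Hom A B) → f ∘ id ≡ f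
    assoc : ∀ {A B C D} (h : Hom C D) (g : Hom B C) (f : Hom A B) →
            (h ∘ g) ∘ f ≡ h ∘ (g ∘ f)

module _ (C D : Category) where
  private
    module C = Category C
    module D = Category D

  record Functor : Set where
    field
      F₀   : C.Obj → D.Obj
      F₁   : ∀ {A B} → C.Hom A B → D.Hom (F₀ A) (F₀ B)
      F-id : ∀ {A} → F₁ (C.id {A}) ≡ D.id
      F-∘  : ∀ {A B E} (g : C.Hom B E) (f : C.Hom A B) →
             F₁ (g C.∘ f) ≡ F₁ g D.∘ F₁ f

module _ (C : Category) where
  open Category C

  record Presheaf : Set₁ where
    field
      Ob   : Obj → Set
      act  : ∀ {U V} → Ob V → Hom U V → Ob U
      act-id : ∀ {V} (γ : Ob V) → act γ id ≡ γ
      act-∘  : ∀ {X U V} (γ : Ob V) (φ : Hom U V) (ψ : Hom X U) →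
               act γ (φ ∘ ψ) ≡ act (act γ φ) ψ

open Presheaf public

module _ {C : Category} where
  open Category C

  record Sub (Δ Γ : Presheaf C) : Set where
    constructor sub
    field
      ap     : ∀ {V} → Ob Δ V → Ob Γ V
      ap-nat : ∀ {U V} (δ : Ob Δ V) (φ : Hom U V) → ap (act Δ δ φ) ≡ act Γ (ap δ) φ
  open Sub public

  infixr 9 _⊚_
  _⊚_ : {Δ Θ Γ : Presheaf C} → Sub Θ Γ → Sub Δ Θ → Sub Δ Γ
  σ ⊚ ρ = sub (λ δ → ap σ (ap ρ δ))
              (λ δ φ → trans (cong (ap σ) (ap-nat ρ δ φ)) (ap-nat σ (ap ρ δ) φ))

  -- The restriction
  -- t ↦ t⟨φ⟩ ∈ T[γ·φ] is written in "displayed" form: it takes any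
  -- proof e : γ·φ ≡ γ' and lands in T[γ'] (for e = refl this is the
  -- paper's t⟨φ⟩; for general e it is t⟨φ⟩ transported along e).
  record Ty (Γ : Presheaf C) : Set₁ where
    field
      Fam     : ∀ {V} → Ob Γ V → Set
      rest    : ∀ {U V} (φ : Hom U V) {γ : Ob Γ V} {γ' : Ob Γ U} →
                act Γ γ φ ≡ γ' → Fam γ → Fam γ'
      rest-id : ∀ {V} {γ : Ob Γ V} (e : act Γ γ id ≡ γ) (t : Fam γ) → rest id e t ≡ t
      rest-∘  : ∀ {X U V} (φ : Hom U V) (ψ : Hom X U)
                {γ : Ob Γ V} {γ' : Ob Γ U} {γ'' : Ob Γ X}
                (e₁ : act Γ γ φ ≡ γ') (e₂ : act Γ γ' ψ ≡ γ'')
                (e₃ : act Γ γ (φ ∘ ψ) ≡ γ'') (t : Fam γ) →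
                rest ψ e₂ (rest φ e₁ t) ≡ rest (φ ∘ ψ) e₃ t
  open Ty public

  record Tm (Γ : Presheaf C) (T : Ty Γ) : Set where
    constructor mkTm
    field
      tm     : ∀ {V} (γ : Ob Γ V) → Fam T γ
      tm-nat : ∀ {U V} (φ : Hom U V) {γ : Ob Γ V} {γ' : Ob Γ U}
               (e : act Γ γ φ ≡ γ') → rest T φ e (tm γ) ≡ tm γ'
  open Tm public

  record TyIso {Γ : Presheaf C} (S T : Ty Γ) : Set where
    field
      to      : ∀ {V} {γ : Ob Γ V} → Fam S γ → Fam T γ
      from    : ∀ {V} {γ : Ob Γ V} → Fam T γ → Fam S γ
      from-to : ∀ {V} {γ : Ob Γ V} (s : Fam S γ) → from (to s) ≡ s
      to-from : ∀ {V} {γ : Ob Γ V} (t : Fam T γ) → to (from t) ≡ t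
      to-nat  : ∀ {U V} (φ : Hom U V) {γ : Ob Γ V} {γ' : Ob Γ U}
                (e : act Γ γ φ ≡ γ') (s : Fam S γ) →
                to (rest S φ e s) ≡ rest T φ e (to s)
      from-nat : ∀ {U V} (φ : Hom U V) {γ : Ob Γ V} {γ' : Ob Γ U}
                (e : act Γ γ φ ≡ γ') (t : Fam T γ) →
                from (rest T φ e t) ≡ rest S φ e (from t)
  open TyIso public

  module _ {Γ : Presheaf C} (T : Ty Γ) where
    rest-irr : ∀ {U V} {φ : Hom U V} {γ γ'} (e e' : act Γ γ φ ≡ γ') (x : Fam T γ) →
               rest T φ e x ≡ rest T φ e' x
    rest-irr e e' x = cong (λ p → rest T _ p x) (uip e e')

    rest-hom : ∀ {U V} {φ φ' : Hom U V} {γ γ'} → φ ≡ φ' →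
               (e : act Γ γ φ ≡ γ') (e' : act Γ γ φ' ≡ γ') (x : Fam T γ) →
               rest T φ e x ≡ rest T φ' e' x
    rest-hom refl e e' x = rest-irr e e' x

    rest-∘! : ∀ {X U V} (φ : Hom U V) (ψ : Hom X U) {γ γ' γ''}
              (e₁ : act Γ γ φ ≡ γ') (e₂ : act Γ γ' ψ ≡ γ'') (x : Fam T γ) →
              rest T ψ e₂ (rest T φ e₁ x) ≡
              rest T (φ ∘ ψ) (trans (act-∘ Γ γ φ ψ) (trans (cong (λ z → act Γ z ψ) e₁) e₂)) x
    rest-∘! φ ψ e₁ e₂ x = rest-∘ T φ ψ e₁ e₂ _ x

    rest-path : ∀ {A : Set} {U V} (f : A → Ob Γ V) (s : (a : A) → Fam T (f a))
                {a₁ a₂ : A} (p : a₁ ≡ a₂) {χ χ' : Hom U V} (q : χ ≡ χ') {γ'}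
                (P : act Γ (f a₁) χ ≡ γ') (P' : act Γ (f a₂) χ' ≡ γ') →
                rest T χ P (s a₁) ≡ rest T χ' P' (s a₂)
    rest-path f s refl refl P P' = rest-irr P P' _

    subst-rest : ∀ {U V} {φ : Hom U V} {γ γ' γ''} (p : γ' ≡ γ'')
                 (e : act Γ γ φ ≡ γ') (x : Fam T γ) →
                 subst (Fam T) p (rest T φ e x) ≡ rest T φ (trans e p) x
    subst-rest refl e x = rest-irr e (trans e refl) x


  infixl 5 _▹_
  _▹_ : (Γ : Presheaf C) → Ty Γ → Presheaf C
  Ob (Γ ▹ T) V = Σ (Ob Γ V) (Fam T)
  act (Γ ▹ T) (γ , x) φ = act Γ γ φ , rest T φ refl x
  act-id (Γ ▹ T) (γ , x) =
    Σ≡ (act-id Γ γ) (trans (subst-rest T (act-id Γ γ) refl x) (rest-id T _ x))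
  act-∘ (Γ ▹ T) (γ , x) φ ψ =
    Σ≡ (act-∘ Γ γ φ ψ)
       (trans (subst-rest T (act-∘ Γ γ φ ψ) refl x) (sym (rest-∘ T φ ψ refl refl _ x)))

  π : {Γ : Presheaf C} {T : Ty Γ} → Sub (Γ ▹ T) Γ
  π = sub proj₁ (λ _ _ → refl)

  infixl 8 _[_]ᵀ _[_]ᵗ
  _[_]ᵀ : {Δ Γ : Presheaf C} → Ty Γ → Sub Δ Γ → Ty Δ
  Fam (T [ σ ]ᵀ) δ = Fam T (ap σ δ)
  rest (_[_]ᵀ {Δ} T σ) φ {δ} e x = rest T φ (trans (sym (ap-nat σ δ φ)) (cong (ap σ) e)) x
  rest-id (T [ σ ]ᵀ) e x = rest-id T _ x
  rest-∘ (T [ σ ]ᵀ) φ ψ e₁ e₂ e₃ x = rest-∘ T φ ψ _ _ _ x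

  _[_]ᵗ : {Δ Γ : Presheaf C} {T : Ty Γ} → Tm Γ T → (σ : Sub Δ Γ) → Tm Δ (T [ σ ]ᵀ)
  tm (t [ σ ]ᵗ) δ = tm t (ap σ δ)
  tm-nat (t [ σ ]ᵗ) φ e = tm-nat t φ _

  module _ {Γ : Presheaf C} (A : Ty Γ) (B : Ty (Γ ▹ A)) where
    private
      Σext : ∀ {V} {γ : Ob Γ V} {x₁ x₂ : Fam A γ} (p : x₁ ≡ x₂)
             {y₁ : Fam B (γ , x₁)} {y₂ : Fam B (γ , x₂)} →
             subst (λ z → Fam B (γ , z)) p y₁ ≡ y₂ →
             _≡_ {A = Σ (Fam A γ) (λ z → Fam B (γ , z))} (x₁ , y₁) (x₂ , y₂)
      Σext refl refl = refl

      substB : ∀ {U V} {χ : Hom U V} {δ : Ob (Γ ▹ A) V} {γ : Ob Γ U} {x₁ x₂ : Fam A γ}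
               (p : x₁ ≡ x₂) (E : act (Γ ▹ A) δ χ ≡ (γ , x₁)) (E' : act (Γ ▹ A) δ χ ≡ (γ , x₂))
               (y : Fam B δ) →
               subst (λ z → Fam B (γ , z)) p (rest B χ E y) ≡ rest B χ E' y
      substB refl E E' y = rest-irr B E E' y

      restE : ∀ {U V} (φ : Hom U V) {γ : Ob Γ V} {γ' : Ob Γ U} (e : act Γ γ φ ≡ γ')
              (x : Fam A γ) → act (Γ ▹ A) (γ , x) φ ≡ (γ' , rest A φ e x)
      restE φ e x = Σ≡ e (subst-rest A e refl x)

    ΣT : Ty Γ
    Fam ΣT γ = Σ (Fam A γ) (λ x → Fam B (γ , x))
    rest ΣT φ e (x , y) = rest A φ e x , rest B φ (restE φ e x) y
    rest-id ΣT {γ = γ} e (x , y) =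
      Σext (rest-id A e x)
           (trans (substB (rest-id A e x) (restE _ e x) (act-id (Γ ▹ A) (γ , x)) y)
                  (rest-id B _ y))
    rest-∘ ΣT φ ψ {γ = γ} e₁ e₂ e₃ (x , y) =
      Σext (rest-∘ A φ ψ e₁ e₂ e₃ x)
           (trans (cong (subst (λ z → Fam B (_ , z)) (rest-∘ A φ ψ e₁ e₂ e₃ x))
                        (rest-∘! B φ ψ (restE φ e₁ x) (restE ψ e₂ (rest A φ e₁ x)) y))
                  (substB (rest-∘ A φ ψ e₁ e₂ e₃ x) _ (restE (φ ∘ ψ) e₃ x) y))

  IdT : {Γ : Presheaf C} {A : Ty Γ} → Tm Γ A → Tm Γ A → Ty Γ
  Fam (IdT a b) γ = tm a γ ≡ tm b γ
  rest (IdT {A = A} a b) φ e p =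
    trans (sym (tm-nat a φ e)) (trans (cong (rest A φ e) p) (tm-nat b φ e))
  rest-id (IdT a b) e p = uip _ _
  rest-∘ (IdT a b) φ ψ e₁ e₂ e₃ p = uip _ _

module _ {C : Category} where
  open Category C

  y : Obj → Presheaf C
  Ob (y W) V = Hom V W
  act (y W) g φ = g ∘ φ
  act-id (y W) g = idʳ g
  act-∘ (y W) g φ ψ = sym (assoc g φ ψ)

module _ {𝒱 𝒲 : Category} (F : Functor 𝒱 𝒲) where
  private
    module V = Category 𝒱
    module W = Category 𝒲
  open Functor F

  F* : Presheaf 𝒲 → Presheaf 𝒱
  Ob (F* Γ) V = Ob Γ (F₀ V)
  act (F* Γ) γ φ = act Γ γ (F₁ φ)
  act-id (F* Γ) γ = trans (cong (act Γ γ) F-id) (act-id Γ γ)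
  act-∘ (F* Γ) γ φ ψ = trans (cong (act Γ γ) (F-∘ φ ψ)) (act-∘ Γ γ (F₁ φ) (F₁ ψ))

  F*y : ∀ {W' W} → W.Hom W' W → Sub (F* (y W')) (F* (y W))
  F*y φ = sub (λ g → φ W.∘ g) (λ g ψ → sym (W.assoc φ g (F₁ ψ)))

module _ (fe : Extensionality 0ℓ 0ℓ) where
  private
    ife = implicit-extensionality fe

  module _ {C : Category} where
    open Category C

    Sub-ext : {Δ Γ : Presheaf C} {σ τ : Sub Δ Γ} →
              (∀ {V} (δ : Ob Δ V) → ap σ δ ≡ ap τ δ) → σ ≡ τ
    Sub-ext {Δ} {Γ} {sub f n} {sub g m} h = lemma (ife (fe h)) n m
      where
      lemma : (p : (λ {V} → f {V}) ≡ g)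
              (n : ∀ {U V} (δ : Ob Δ V) (φ : Hom U V) → f (act Δ δ φ) ≡ act Γ (f δ) φ)
              (m : ∀ {U V} (δ : Ob Δ V) (φ : Hom U V) → g (act Δ δ φ) ≡ act Γ (g δ) φ) →
              sub f n ≡ sub g m
      lemma refl n m = cong (sub f) (ife (ife (fe λ δ → fe λ φ → uip _ _)))

    Tm-ext : {Γ : Presheaf C} {T : Ty Γ} {t u : Tm Γ T} →
             (∀ {V} (γ : Ob Γ V) → tm t γ ≡ tm u γ) → t ≡ u
    Tm-ext {Γ} {T} {mkTm f n} {mkTm g m} h =
      lemma (ife (fe h)) n m
      where
      lemma : (p : (λ {V} → f {V}) ≡ g)
              (n : ∀ {U V} (φ : Hom U V) {γ : Ob Γ V} {γ' : Ob Γ U}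
                   (e : act Γ γ φ ≡ γ') → rest T φ e (f γ) ≡ f γ')
              (m : ∀ {U V} (φ : Hom U V) {γ : Ob Γ V} {γ' : Ob Γ U}
                   (e : act Γ γ φ ≡ γ') → rest T φ e (g γ) ≡ g γ') →
              mkTm f n ≡ mkTm g m
      lemma refl n m =
        cong (mkTm f)
             (ife (ife (fe λ φ → ife (ife (fe λ e → uip _ _)))))

  module _ {𝒱 𝒲 : Category} (F : Functor 𝒱 𝒲) where
    private
      module V = Category 𝒱
      module W = Category 𝒲
    open Functor F

    F₊ : Presheaf 𝒱 → Presheaf 𝒲
    Ob (F₊ Γ) W = Sub (F* F (y W)) Γ
    act (F₊ Γ) σ φ = σ ⊚ F*y F φ
    act-id (F₊ Γ) σ = Sub-ext (λ g → cong (ap σ) (W.idˡ g))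
    act-∘ (F₊ Γ) σ φ ψ = Sub-ext (λ g → cong (ap σ) (W.assoc φ ψ g))

    -- (F_* T)[σ] = Tm(F^* y W, T[σ]),  restriction t ↦ t[F^* y φ]
    -- (transported, via an identity restriction, along e : σ·φ ≡ σ')
    F₊ᵀ : {Γ : Presheaf 𝒱} → Ty Γ → Ty (F₊ Γ)
    Fam (F₊ᵀ T) {W} σ = Tm (F* F (y W)) (T [ σ ]ᵀ)
    rest (F₊ᵀ {Γ} T) φ {σ} {σ'} e t = record
      { tm = λ g → rest T V.id (P g) (tm t (φ W.∘ g))
      ; tm-nat = λ ψ {g} {g'} e₂ →
          trans (rest-∘! T V.id ψ (P g) _ _)
          (trans (rest-hom T (trans (V.idˡ ψ) (sym (V.idʳ ψ))) _ _ _)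
          (sym (trans (cong (rest T V.id (P g'))
                            (sym (tm-nat t ψ (trans (W.assoc φ g (F₁ ψ)) (cong (φ W.∘_) e₂)))))
                      (rest-∘! T ψ V.id _ (P g') _))))
      }
      where
      P : ∀ {U} (g : W.Hom (F₀ U) _) → act Γ (ap σ (φ W.∘ g)) V.id ≡ ap σ' g
      P g = trans (act-id Γ _) (cong (λ τ → ap τ g) e)
    rest-id (F₊ᵀ {Γ} T) {γ = σ} e t = Tm-ext λ g →
      trans (rest-path T (ap σ) (tm t) (W.idˡ g) refl _ (act-id Γ _)) (rest-id T _ _)
    rest-∘ (F₊ᵀ {Γ} T) φ ψ {γ = σ} e₁ e₂ e₃ t = Tm-ext λ g →
      trans (rest-∘! T V.id V.id _ _ _)
            (rest-path T (ap σ) (tm t) (sym (W.assoc φ ψ g)) (V.idˡ V.id) _ _)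

    F₊ᵗ : {Γ : Presheaf 𝒱} {T : Ty Γ} → Tm Γ T → Tm (F₊ Γ) (F₊ᵀ T)
    tm (F₊ᵗ t) σ = t [ σ ]ᵗ
    tm-nat (F₊ᵗ {Γ} {T} t) φ {σ} {σ'} e = Tm-ext λ g →
      trans (rest-path T (λ γ → γ) (tm t) (cong (λ τ → ap τ g) e) refl _ (act-id Γ _))
            (rest-id T _ _)

    θ : {Γ : Presheaf 𝒱} {A : Ty Γ} → Sub (F₊ Γ ▹ F₊ᵀ A) (F₊ (Γ ▹ A))
    θ {Γ} {A} = sub
      (λ { (σ , a) → sub (λ g → ap σ g , tm a g)
                         (λ g ψ → Σ≡ {A = Ob Γ _} {P = Fam A} (ap-nat σ g ψ)
                           (trans (cong (subst (Fam A) (ap-nat σ g ψ)) (sym (tm-nat a ψ refl)))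
                                  (trans (subst-rest A (ap-nat σ g ψ) _ _) (rest-irr A _ _ _)))) })
      (λ { (σ , a) φ → Sub-ext λ g → Σ≡ {A = Ob Γ _} {P = Fam A} refl (rest-id A _ _) })

    -- the comprehension map (F_*π , F_*ξ) : F_*(Γ.A) → (F_*Γ).(F_*A), on elements:
    -- τ ↦ (π ∘ τ , ξ[τ])
    compOb : {Γ : Presheaf 𝒱} {A : Ty Γ} {W : W.Obj} →
             Ob (F₊ (Γ ▹ A)) W → Ob (F₊ Γ ▹ F₊ᵀ A) W
    compOb {Γ} {A} τ = π ⊚ τ , record
      { tm = λ g → proj₂ (ap τ g)
      ; tm-nat = λ ψ {g} {g'} e →
          let Q = trans (sym (ap-nat τ g ψ)) (cong (ap τ) e) in
          trans (rest-irr A _ _ _)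
          (trans (sym (subst-rest A (cong proj₁ Q) refl _)) (snd Q))
      }
      where
      snd : ∀ {U} {p₁ p₂ : Ob (Γ ▹ A) U} (Q : p₁ ≡ p₂) →
            subst (Fam A) (cong proj₁ Q) (proj₂ p₁) ≡ proj₂ p₂
      snd refl = refl

module Submission where

-- Elements of (F_* T)[σ] are terms over the representable-like presheaf
-- F^* y W, and all constructions act on such terms pointwise.  The proof
-- is therefore a matter of comparing terms pointwise (function
-- extensionality, 'Tm-ext') while the coherence proofs carried inside
-- restrictions are irrelevant (UIP).

open import Defs
open import Level using (0ℓ)
open import Relation.Binary.PropositionalEquality
  using (_≡_; refl; trans; cong; subst)
open import Axiom.Extensionality.Propositional using (Extensionality)
open import Axiom.UniquenessOfIdentityProofs.WithK using (uip)
open import Data.Product using (Σ; _,_; proj₁; proj₂; _×_)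
open import Data.Product.Properties.WithK using (,-injectiveʳ)

module _ {C : Category} where
  open Category C

  module _ {Γ : Presheaf C} {A : Ty Γ} (B : Ty (Γ ▹ A)) where

    rest-transport : ∀ {U V} {χ : Hom U V} {δ : Ob (Γ ▹ A) V} {γ : Ob Γ U}
                     {x₁ x₂ : Fam A γ} (p : x₁ ≡ x₂)
                     (E₁ : act (Γ ▹ A) δ χ ≡ (γ , x₁)) (E₂ : act (Γ ▹ A) δ χ ≡ (γ , x₂))
                     (y : Fam B δ) →
                     subst (λ z → Fam B (γ , z)) p (rest B χ E₁ y) ≡ rest B χ E₂ y
    rest-transport refl E₁ E₂ y = rest-irr B E₁ E₂ y

    rest-snd : ∀ {U V} {χ : Hom U V} {δ : Ob (Γ ▹ A) V} {γ : Ob Γ U}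
               {x₀ x : Fam A γ} {y₀ : Fam B δ} {y : Fam B (γ , x)}
               (E₀ : act (Γ ▹ A) δ χ ≡ (γ , x₀)) (E : act (Γ ▹ A) δ χ ≡ (γ , x)) →
               _≡_ {A = Σ (Fam A γ) (λ z → Fam B (γ , z))} (x₀ , rest B χ E₀ y₀) (x , y) →
               rest B χ E y₀ ≡ y
    rest-snd E₀ E refl = rest-irr B E E₀ _

    rest-pair-irr : ∀ {U V} {χ : Hom U V} {γ : Ob Γ V} {γ' : Ob Γ U}
                    (e₁ e₂ : act Γ γ χ ≡ γ') (x : Fam A γ) (y : Fam B (γ , x))
                    (E₁ : act (Γ ▹ A) (γ , x) χ ≡ (γ' , rest A χ e₁ x))
                    (E₂ : act (Γ ▹ A) (γ , x) χ ≡ (γ' , rest A χ e₂ x)) →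
                    _≡_ {A = Σ (Fam A γ') (λ z → Fam B (γ' , z))}
                      (rest A χ e₁ x , rest B χ E₁ y) (rest A χ e₂ x , rest B χ E₂ y)
    rest-pair-irr e₁ e₂ x y E₁ E₂ with uip e₁ e₂
    ... | refl = cong (rest A _ e₁ x ,_) (rest-irr B E₁ E₂ y)

  tm-subst : {Δ Γ : Presheaf C} {T : Ty Γ} {σ σ' : Sub Δ Γ} (p : σ ≡ σ')
             (t : Tm Δ (T [ σ ]ᵀ)) {V : Obj} (δ : Ob Δ V) →
             tm (subst (λ τ → Tm Δ (T [ τ ]ᵀ)) p t) δ ≡
             subst (Fam T) (cong (λ τ → ap τ δ) p) (tm t δ)
  tm-subst refl t δ = refl

module Pushforward (fe : Extensionality 0ℓ 0ℓ) {𝒱 𝒲 : Category} (F : Functor 𝒱 𝒲)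
                   {Γ : Presheaf 𝒱} where
  private
    module W = Category 𝒲

  module Comprehension (A : Ty Γ) where

    θ-compOb : ∀ {W} (τ : Ob (F₊ fe F (Γ ▹ A)) W) →
               ap (θ fe F {A = A}) (compOb fe F {A = A} τ) ≡ τ
    θ-compOb τ = Sub-ext fe (λ g → refl)

    -- The first component of compOb (θ (σ , a)) is σ only propositionally
    -- (as a natural transformation), so the second needs 'tm-subst'.
    compOb-θ : ∀ {W} (x : Ob (F₊ fe F Γ ▹ F₊ᵀ fe F A) W) →
               compOb fe F {A = A} (ap (θ fe F {A = A}) x) ≡ x
    compOb-θ (σ , a) = Σ≡ {P = Fam (F₊ᵀ fe F A)} π∘θ≡σ (Tm-ext fe λ g →
      trans (tm-subst {T = A} π∘θ≡σ _ g)
            (cong (λ q → subst (Fam A) q (tm a g)) (uip _ refl)))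
      where
      π∘θ≡σ : π ⊚ ap (θ fe F {A = A}) (σ , a) ≡ σ
      π∘θ≡σ = Sub-ext fe (λ g → refl)

  module SigmaTypes (A : Ty Γ) (B : Ty (Γ ▹ A)) where

    ΣF₊ : Ty (F₊ fe F Γ)
    ΣF₊ = ΣT (F₊ᵀ fe F A) (F₊ᵀ fe F B [ θ fe F {A = A} ]ᵀ)

    pair-ext : ∀ {W} {σ : Ob (F₊ fe F Γ) W} (a a' : Fam (F₊ᵀ fe F A) σ)
               (b : Fam (F₊ᵀ fe F B [ θ fe F {A = A} ]ᵀ) (σ , a))
               (b' : Fam (F₊ᵀ fe F B [ θ fe F {A = A} ]ᵀ) (σ , a')) →
               (∀ {V} (g : Ob (F* F (y W)) V) →
                  _≡_ {A = Σ (Fam A (ap σ g)) (λ z → Fam B (ap σ g , z))}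
                    (tm a g , tm b g) (tm a' g , tm b' g)) →
               _≡_ {A = Fam ΣF₊ σ} (a , b) (a' , b')
    pair-ext a a' b b' pointwise with Tm-ext fe {t = a} {u = a'} (λ g → cong proj₁ (pointwise g))
    ... | refl = cong (a ,_) (Tm-ext fe λ g → ,-injectiveʳ (pointwise g))

    split : ∀ {W} {σ : Ob (F₊ fe F Γ) W} → Fam (F₊ᵀ fe F (ΣT A B)) σ → Fam ΣF₊ σ
    split t =
      mkTm (λ g → proj₁ (tm t g)) (λ ψ e → cong proj₁ (tm-nat t ψ e)) ,
      mkTm (λ g → proj₂ (tm t g)) (λ ψ e → rest-snd B _ _ (tm-nat t ψ e))

    pair : ∀ {W} {σ : Ob (F₊ fe F Γ) W} → Fam ΣF₊ σ → Fam (F₊ᵀ fe F (ΣT A B)) σ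
    pair (a , b) = mkTm (λ g → tm a g , tm b g) λ ψ e →
      Σ≡ {P = λ z → Fam B (_ , z)} (tm-nat a ψ e)
         (trans (rest-transport B _ _ _ _) (tm-nat b ψ e))

    -- Naturality of split: both sides restrict the same pair pointwise.
    split-nat : ∀ {U V} (φ : W.Hom U V) {σ : Ob (F₊ fe F Γ) V} {σ' : Ob (F₊ fe F Γ) U}
                (e : act (F₊ fe F Γ) σ φ ≡ σ') (t : Fam (F₊ᵀ fe F (ΣT A B)) σ) →
                split (rest (F₊ᵀ fe F (ΣT A B)) φ e t) ≡ rest ΣF₊ φ e (split t)
    split-nat φ e t = pair-ext _ _ _ _ λ g → rest-pair-irr B _ _ _ _ _ _

    F₊Σ-iso : TyIso (F₊ᵀ fe F (ΣT A B)) ΣF₊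
    to F₊Σ-iso = split
    from F₊Σ-iso = pair
    from-to F₊Σ-iso t = Tm-ext fe λ g → refl
    to-from F₊Σ-iso (a , b) = pair-ext _ a _ b λ g → refl
    to-nat F₊Σ-iso = split-nat
    from-nat F₊Σ-iso φ e (a , b) = Tm-ext fe λ g →
      Σ≡ {P = λ z → Fam B (_ , z)} refl (rest-irr B _ _ _)

  -- Both sides are propositions: a term of F_*(a = b) is a family of
  -- equalities a[σ g] ≡ b[σ g], i.e. (by extensionality) a[σ] ≡ b[σ].
  F₊Id-iso : (A : Ty Γ) (a b : Tm Γ A) →
             TyIso (F₊ᵀ fe F (IdT a b)) (IdT (F₊ᵗ fe F a) (F₊ᵗ fe F b))
  to (F₊Id-iso A a b) t = Tm-ext fe (tm t)
  from (F₊Id-iso A a b) p = mkTm (λ g → cong (λ u → tm u g) p) (λ _ _ → uip _ _)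
  from-to (F₊Id-iso A a b) t = Tm-ext fe λ g → uip _ _
  to-from (F₊Id-iso A a b) p = uip _ _
  to-nat (F₊Id-iso A a b) φ e t = uip _ _
  from-nat (F₊Id-iso A a b) φ e p = Tm-ext fe λ g → uip _ _

mainTheorem5 : (fe : Extensionality 0ℓ 0ℓ) {𝒱 𝒲 : Category} (F : Functor 𝒱 𝒲)
    {Γ : Presheaf 𝒱} →
    -- Σ-types
    ((A : Ty Γ) (B : Ty (Γ ▹ A)) →
      -- θ is the inverse of the comprehension isomorphism (F_*π , F_*ξ)
      ((∀ {W} (τ : Ob (F₊ fe F (Γ ▹ A)) W) → ap (θ fe F {A = A}) (compOb fe F {A = A} τ) ≡ τ)
       × (∀ {W} (x : Ob (F₊ fe F Γ ▹ F₊ᵀ fe F A) W) → compOb fe F {A = A} (ap (θ fe F {A = A}) x) ≡ x))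
      ×
      Σ (TyIso (F₊ᵀ fe F (ΣT A B)) (ΣT (F₊ᵀ fe F A) (F₊ᵀ fe F B [ θ fe F {A = A} ]ᵀ))) λ ι →
        -- compatibility with projections
        (∀ {W} {σ : Ob (F₊ fe F Γ) W} (t : Fam (F₊ᵀ fe F (ΣT A B)) σ) {V}
           (g : Ob (F* F (y W)) V) →
           (tm (proj₁ (to ι t)) g , tm (proj₂ (to ι t)) g) ≡ tm t g)
        ×
        -- compatibility with pairing
        (∀ {W} {σ : Ob (F₊ fe F Γ) W} (a : Fam (F₊ᵀ fe F A) σ)
           (b : Fam (F₊ᵀ fe F B [ θ fe F {A = A} ]ᵀ) (σ , a)) {V} (g : Ob (F* F (y W)) V) →
           tm (from ι (a , b)) g ≡ (tm a g , tm b g)))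
    ×
    -- identity types
    ((A : Ty Γ) (a b : Tm Γ A) →
      TyIso (F₊ᵀ fe F (IdT a b)) (IdT (F₊ᵗ fe F a) (F₊ᵗ fe F b)))
mainTheorem5 fe F {Γ} =
  (λ A B → (θ-compOb A , compOb-θ A) ,
           -- split and pair act pointwise, so both compatibilities hold by refl
           F₊Σ-iso A B , (λ t g → refl) , (λ a b g → refl)) ,
  F₊Id-iso
  where
  open Pushforward fe F {Γ}
  open Comprehension
  open SigmaTypes
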